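{- For any $\Sigma$-formulas $S_0(p_0,\ldots,p_n),\ldots,S_n(p_0,\ldots,p_n)$ there are $\mathcal{L}''$-formulas $F_0,\ldots,F_n$, containing only predicate symbols, propositional variables and free variables occurring in $S_0,\ldots,S_n$ and not containing $p_0,\ldots,p_n$, such that for every $i\leq n$, $\mathbf{QGL}\vdash F_i\leftrightarrow S_i(F_0,\ldots,F_n)$.
   Context: $\mathcal{L}''$ is the predicate modal language with individual variables, constants $\top,\bot$, connectives $\neg,\to,\lor,\land$, quantifiers $\forall,\exists$, modal operator $\Box$, countably many predicate symbols of each arity, and countably infinitely many propositional variables. $S_i(F_0,\ldots,F_n)$ denotes simultaneous substitution of $F_j$ for the propositional variable $p_j$. $\mathbf{QGL}$ (over $\mathcal{L}''$): all instances of the axioms of classical first-order predicate logic, $\Box(A\to B)\to(\Box A\to\Box B)$, $\Box A\to\Box\Box A$, $\Box(\Box A\to A)\to\Box A$, with rules modus ponens, generalization and necessitation. $\Sigma$-formulas: every formula $\Box B$ is a $\Sigma$-formula, and if $B,C$ are $\Sigma$-formulas then so are $B\lor C$, $B\land C$, $\exists u B$. Standing convention: formulas are taken (after renaming bound variables) so that no variable occurs both free and bound in a formula. -}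

module Defs where

open import Data.Nat using (ℕ; suc; _<_; _<?_; _≡ᵇ_)
open import Data.Bool using (Bool; true; false; not; _∧_; _∨_; if_then_else_)
open import Data.Fin using (Fin; fromℕ<)
open import Data.Vec using (Vec; map)
open import Data.Vec.Membership.Propositional using () renaming (_∈_ to _∈ᵛ_)
open import Data.Product using (_×_)
open import Data.Sum using (_⊎_)
open import Data.Unit using (⊤)
open import Relation.Nullary using (¬_; yes; no)
open import Relation.Binary.PropositionalEquality using (_≡_; _≢_)

Var : Set
Var = ℕ

-- Formulas of the predicate modal language L''.
-- rel k j xs : the j-th predicate symbol of arity k applied to variables xs.
-- pv j       : the propositional variable p_j.
data Form : Set where
  top bot : Form
  neg     : Form → Form
  _⇒_ _∨ᶠ_ _∧ᶠ_ : Form → Form → Form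
  all ex  : Var → Form → Form
  box     : Form → Form
  pv      : ℕ → Form
  rel     : (k j : ℕ) → Vec Var k → Form

infixr 4 _⇒_
infixr 5 _∨ᶠ_
infixr 6 _∧ᶠ_

_⇔_ : Form → Form → Form
A ⇔ B = (A ⇒ B) ∧ᶠ (B ⇒ A)

data FreeIn (x : Var) : Form → Set where
  rel   : ∀ {k j xs} → x ∈ᵛ xs → FreeIn x (rel k j xs)
  neg   : ∀ {A} → FreeIn x A → FreeIn x (neg A)
  ⇒ˡ    : ∀ {A B} → FreeIn x A → FreeIn x (A ⇒ B)
  ⇒ʳ    : ∀ {A B} → FreeIn x B → FreeIn x (A ⇒ B)
  ∨ˡ    : ∀ {A B} → FreeIn x A → FreeIn x (A ∨ᶠ B)
  ∨ʳ    : ∀ {A B} → FreeIn x B → FreeIn x (A ∨ᶠ B)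
  ∧ˡ    : ∀ {A B} → FreeIn x A → FreeIn x (A ∧ᶠ B)
  ∧ʳ    : ∀ {A B} → FreeIn x B → FreeIn x (A ∧ᶠ B)
  all   : ∀ {y A} → y ≢ x → FreeIn x A → FreeIn x (all y A)
  ex    : ∀ {y A} → y ≢ x → FreeIn x A → FreeIn x (ex y A)
  box   : ∀ {A} → FreeIn x A → FreeIn x (box A)

data BoundIn (x : Var) : Form → Set where
  neg   : ∀ {A} → BoundIn x A → BoundIn x (neg A)
  ⇒ˡ    : ∀ {A B} → BoundIn x A → BoundIn x (A ⇒ B)
  ⇒ʳ    : ∀ {A B} → BoundIn x B → BoundIn x (A ⇒ B)
  ∨ˡ    : ∀ {A B} → BoundIn x A → BoundIn x (A ∨ᶠ B)
  ∨ʳ    : ∀ {A B} → BoundIn x B → BoundIn x (A ∨ᶠ B)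
  ∧ˡ    : ∀ {A B} → BoundIn x A → BoundIn x (A ∧ᶠ B)
  ∧ʳ    : ∀ {A B} → BoundIn x B → BoundIn x (A ∧ᶠ B)
  allₕ  : ∀ {A} → BoundIn x (all x A)
  exₕ   : ∀ {A} → BoundIn x (ex x A)
  all   : ∀ {y A} → BoundIn x A → BoundIn x (all y A)
  ex    : ∀ {y A} → BoundIn x A → BoundIn x (ex y A)
  box   : ∀ {A} → BoundIn x A → BoundIn x (box A)

data PredIn (k j : ℕ) : Form → Set where
  here  : ∀ {xs} → PredIn k j (rel k j xs)
  neg   : ∀ {A} → PredIn k j A → PredIn k j (neg A)
  ⇒ˡ    : ∀ {A B} → PredIn k j A → PredIn k j (A ⇒ B)
  ⇒ʳ    : ∀ {A B} → PredIn k j B → PredIn k j (A ⇒ B)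
  ∨ˡ    : ∀ {A B} → PredIn k j A → PredIn k j (A ∨ᶠ B)
  ∨ʳ    : ∀ {A B} → PredIn k j B → PredIn k j (A ∨ᶠ B)
  ∧ˡ    : ∀ {A B} → PredIn k j A → PredIn k j (A ∧ᶠ B)
  ∧ʳ    : ∀ {A B} → PredIn k j B → PredIn k j (A ∧ᶠ B)
  all   : ∀ {y A} → PredIn k j A → PredIn k j (all y A)
  ex    : ∀ {y A} → PredIn k j A → PredIn k j (ex y A)
  box   : ∀ {A} → PredIn k j A → PredIn k j (box A)

data PvIn (j : ℕ) : Form → Set where
  here  : PvIn j (pv j)
  neg   : ∀ {A} → PvIn j A → PvIn j (neg A)
  ⇒ˡ    : ∀ {A B} → PvIn j A → PvIn j (A ⇒ B)
  ⇒ʳ    : ∀ {A B} → PvIn j B → PvIn j (A ⇒ B)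
  ∨ˡ    : ∀ {A B} → PvIn j A → PvIn j (A ∨ᶠ B)
  ∨ʳ    : ∀ {A B} → PvIn j B → PvIn j (A ∨ᶠ B)
  ∧ˡ    : ∀ {A B} → PvIn j A → PvIn j (A ∧ᶠ B)
  ∧ʳ    : ∀ {A B} → PvIn j B → PvIn j (A ∧ᶠ B)
  all   : ∀ {y A} → PvIn j A → PvIn j (all y A)
  ex    : ∀ {y A} → PvIn j A → PvIn j (ex y A)
  box   : ∀ {A} → PvIn j A → PvIn j (box A)

data IsΣ : Form → Set where
  box : ∀ {B} → IsΣ (box B)
  or  : ∀ {B C} → IsΣ B → IsΣ C → IsΣ (B ∨ᶠ C)
  and : ∀ {B C} → IsΣ B → IsΣ C → IsΣ (B ∧ᶠ C)
  ex  : ∀ {u B} → IsΣ B → IsΣ (ex u B)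

-- Substitution of formulas for propositional variables (literal replacement)
substP : (ℕ → Form) → Form → Form
substP σ top = top
substP σ bot = bot
substP σ (neg A) = neg (substP σ A)
substP σ (A ⇒ B) = substP σ A ⇒ substP σ B
substP σ (A ∨ᶠ B) = substP σ A ∨ᶠ substP σ B
substP σ (A ∧ᶠ B) = substP σ A ∧ᶠ substP σ B
substP σ (all x A) = all x (substP σ A)
substP σ (ex x A) = ex x (substP σ A)
substP σ (box A) = box (substP σ A)
substP σ (pv j) = σ j
substP σ (rel k j xs) = rel k j xs

tuple : ∀ {n} → (Fin (suc n) → Form) → ℕ → Form
tuple {n} F j with j <? suc n
... | yes j<n = F (fromℕ< j<n)
... | no  _   = pv j

_⟦_⟧ : ∀ {n} → Form → (Fin (suc n) → Form) → Form
S ⟦ F ⟧ = substP (tuple F) S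

_[_/_] : Form → Var → Var → Form
top [ y / x ] = top
bot [ y / x ] = bot
neg A [ y / x ] = neg (A [ y / x ])
(A ⇒ B) [ y / x ] = A [ y / x ] ⇒ B [ y / x ]
(A ∨ᶠ B) [ y / x ] = A [ y / x ] ∨ᶠ B [ y / x ]
(A ∧ᶠ B) [ y / x ] = A [ y / x ] ∧ᶠ B [ y / x ]
all z A [ y / x ] = if z ≡ᵇ x then all z A else all z (A [ y / x ])
ex z A [ y / x ] = if z ≡ᵇ x then ex z A else ex z (A [ y / x ])
box A [ y / x ] = box (A [ y / x ])
pv j [ y / x ] = pv j
rel k j xs [ y / x ] = rel k j (map (λ z → if z ≡ᵇ x then y else z) xs)

FreeFor : Var → Var → Form → Set
FreeFor y x (neg A) = FreeFor y x A
FreeFor y x (A ⇒ B) = FreeFor y x A × FreeFor y x B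
FreeFor y x (A ∨ᶠ B) = FreeFor y x A × FreeFor y x B
FreeFor y x (A ∧ᶠ B) = FreeFor y x A × FreeFor y x B
FreeFor y x (all z A) = ¬ FreeIn x (all z A) ⊎ (z ≢ y × FreeFor y x A)
FreeFor y x (ex z A) = ¬ FreeIn x (ex z A) ⊎ (z ≢ y × FreeFor y x A)
FreeFor y x (box A) = FreeFor y x A
FreeFor y x _ = ⊤

-- Propositional evaluation: formulas not built by ⊤,⊥,¬,→,∨,∧ are
-- treated as propositional atoms, valued by v.
eval : (Form → Bool) → Form → Bool
eval v top = true
eval v bot = false
eval v (neg A) = not (eval v A)
eval v (A ⇒ B) = not (eval v A) ∨ eval v B
eval v (A ∨ᶠ B) = eval v A ∨ eval v B
eval v (A ∧ᶠ B) = eval v A ∧ eval v B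
eval v A = v A

Tautology : Form → Set
Tautology A = ∀ (v : Form → Bool) → eval v A ≡ true

data Axiom : Form → Set where
  taut   : ∀ {A} → Tautology A → Axiom A
  ∀-inst : ∀ {A x y} → FreeFor y x A → Axiom (all x A ⇒ A [ y / x ])
  ∀-ax   : ∀ {A B x} → ¬ FreeIn x A → Axiom (all x (A ⇒ B) ⇒ (A ⇒ all x B))
  ∃-intr : ∀ {A x y} → FreeFor y x A → Axiom (A [ y / x ] ⇒ ex x A)
  ∃-elim : ∀ {A B x} → ¬ FreeIn x B → Axiom (all x (A ⇒ B) ⇒ (ex x A ⇒ B))
  K      : ∀ {A B} → Axiom (box (A ⇒ B) ⇒ (box A ⇒ box B))
  four   : ∀ {A} → Axiom (box A ⇒ box (box A))
  löb    : ∀ {A} → Axiom (box (box A ⇒ A) ⇒ box A)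

data QGL⊢_ : Form → Set where
  ax  : ∀ {A} → Axiom A → QGL⊢ A
  mp  : ∀ {A B} → QGL⊢ (A ⇒ B) → QGL⊢ A → QGL⊢ B
  gen : ∀ {A} x → QGL⊢ A → QGL⊢ all x A
  nec : ∀ {A} → QGL⊢ A → QGL⊢ box A

module Submission where

-- A Σ-formula T(p) is provably boxed (T → □T), and p occurs in it only under
-- □. Hence T(⊤) is a fixed point: □T(⊤) gives □(T(⊤) ↔ ⊤), so by substitution
-- of equivalents under □ it gives T(T(⊤)) ↔ T(⊤); from this one derives
-- □E → E for E := T(⊤) ↔ T(T(⊤)), and Löb's axiom yields E. Simultaneous
-- fixed points follow Bekić: solve p_n ↔ S_n with p_0, …, p_{n-1} as
-- parameters, substitute the solution into S_0, …, S_{n-1} and recurse.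
-- Substitution only moves symbols already present in the S_i, so the fixed
-- points stay in their vocabulary and the hypothesis that no variable is both
-- bound and free is preserved; that hypothesis is what lets substitution of
-- equivalents pass through quantifiers.

open import Defs
open import Data.Bool using (Bool; true; false; not; _∧_; _∨_; T; if_then_else_)
open import Data.Empty using (⊥-elim)
open import Data.Fin using (Fin; toℕ; fromℕ<) renaming (zero to #0; suc to 1+)
open import Data.Fin.Properties using (toℕ<n; toℕ-fromℕ<; fromℕ<-toℕ)
open import Data.Nat using (ℕ; zero; suc; _≡ᵇ_; _≟_; _<_; _≤_; _<?_; s≤s⁻¹)
open import Data.Nat.Properties using (≡ᵇ⇒≡; ≡⇒≡ᵇ; ≤-refl; <-irrefl; m<n⇒m<1+n; ≤∧≢⇒<; ≮⇒≥)
open import Data.Product using (Σ; ∃; _×_; _,_; proj₁; proj₂)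
open import Data.Product as Prod using ()
open import Data.Sum using (_⊎_; inj₁; inj₂; [_,_]′)
open import Data.Sum as Sum using ()
open import Data.Unit using (⊤)
open import Data.Vec using (Vec; []; _∷_; lookup; map)
open import Data.Vec.Properties using (lookup-map; map-cong; map-id)
open import Data.Vec.Relation.Unary.All using (All; []; _∷_)
open import Function using (_∘_)
open import Relation.Binary.PropositionalEquality using (_≡_; _≢_; refl; sym; trans; cong; cong₂; subst; subst₂)
open import Relation.Nullary using (¬_; yes; no)

data Schema (n : ℕ) : Set where
  at : Fin n → Schema n
  ⊤ˢ ⊥ˢ : Schema n
  ¬ˢ_ : Schema n → Schema n
  _⇒ˢ_ _∨ˢ_ _∧ˢ_ : Schema n → Schema n → Schema n

infix  9 ¬ˢ_
infixr 6 _⇒ˢ_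
infixr 7 _∨ˢ_
infixr 8 _∧ˢ_
infix  5.5 _⇔ˢ_

_⇔ˢ_ : ∀ {n} → Schema n → Schema n → Schema n
φ ⇔ˢ ψ = (φ ⇒ˢ ψ) ∧ˢ (ψ ⇒ˢ φ)

⟪_⟫ : ∀ {n} → Schema n → Vec Form n → Form
⟪ at i ⟫ ρ = lookup ρ i
⟪ ⊤ˢ ⟫ ρ = top
⟪ ⊥ˢ ⟫ ρ = bot
⟪ ¬ˢ φ ⟫ ρ = neg (⟪ φ ⟫ ρ)
⟪ φ ⇒ˢ ψ ⟫ ρ = ⟪ φ ⟫ ρ ⇒ ⟪ ψ ⟫ ρ
⟪ φ ∨ˢ ψ ⟫ ρ = ⟪ φ ⟫ ρ ∨ᶠ ⟪ ψ ⟫ ρ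
⟪ φ ∧ˢ ψ ⟫ ρ = ⟪ φ ⟫ ρ ∧ᶠ ⟪ ψ ⟫ ρ

evalˢ : ∀ {n} → Vec Bool n → Schema n → Bool
evalˢ b (at i) = lookup b i
evalˢ b ⊤ˢ = true
evalˢ b ⊥ˢ = false
evalˢ b (¬ˢ φ) = not (evalˢ b φ)
evalˢ b (φ ⇒ˢ ψ) = not (evalˢ b φ) ∨ evalˢ b ψ
evalˢ b (φ ∨ˢ ψ) = evalˢ b φ ∨ evalˢ b ψ
evalˢ b (φ ∧ˢ ψ) = evalˢ b φ ∧ evalˢ b ψ

eval-⟪⟫ : ∀ {n} v (φ : Schema n) ρ → eval v (⟪ φ ⟫ ρ) ≡ evalˢ (map (eval v) ρ) φ
eval-⟪⟫ v (at i) ρ = sym (lookup-map i (eval v) ρ)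
eval-⟪⟫ v ⊤ˢ ρ = refl
eval-⟪⟫ v ⊥ˢ ρ = refl
eval-⟪⟫ v (¬ˢ φ) ρ = cong not (eval-⟪⟫ v φ ρ)
eval-⟪⟫ v (φ ⇒ˢ ψ) ρ = cong₂ (λ a b → not a ∨ b) (eval-⟪⟫ v φ ρ) (eval-⟪⟫ v ψ ρ)
eval-⟪⟫ v (φ ∨ˢ ψ) ρ = cong₂ _∨_ (eval-⟪⟫ v φ ρ) (eval-⟪⟫ v ψ ρ)
eval-⟪⟫ v (φ ∧ˢ ψ) ρ = cong₂ _∧_ (eval-⟪⟫ v φ ρ) (eval-⟪⟫ v ψ ρ)

valid : (n : ℕ) → (Vec Bool n → Bool) → Bool
valid zero f = f []
valid (suc n) f = valid n (λ b → f (true ∷ b)) ∧ valid n (λ b → f (false ∷ b))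

valid-sound : ∀ n f → valid n f ≡ true → ∀ b → f b ≡ true
valid-sound zero f e [] = e
valid-sound (suc n) f e (true ∷ b) with valid n (λ b → f (true ∷ b)) in e₁
... | true = valid-sound n _ e₁ b
valid-sound (suc n) f e (false ∷ b) with valid n (λ b → f (true ∷ b))
... | true = valid-sound n _ e b

tautology : ∀ {n} (φ : Schema n) → valid n (λ b → evalˢ b φ) ≡ true → (ρ : Vec Form n) → QGL⊢ ⟪ φ ⟫ ρ
tautology {n} φ v ρ = ax (taut λ w → trans (eval-⟪⟫ w φ ρ) (valid-sound n _ v (map (eval w) ρ)))

_⇒*_ : ∀ {n k} → Vec (Schema n) k → Schema n → Schema n
[] ⇒* ψ = ψ
(φ ∷ φs) ⇒* ψ = φ ⇒ˢ (φs ⇒* ψ)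

-- The validity side condition is discharged by refl: the truth table is
-- evaluated during type checking.
by-taut : ∀ {n k} (φs : Vec (Schema n) k) (ψ : Schema n) → valid n (λ b → evalˢ b (φs ⇒* ψ)) ≡ true →
          (ρ : Vec Form n) → All (λ φ → QGL⊢ ⟪ φ ⟫ ρ) φs → QGL⊢ ⟪ ψ ⟫ ρ
by-taut φs ψ v ρ ds = go φs ds (tautology (φs ⇒* ψ) v ρ)
  where
  go : ∀ {k} (φs : Vec _ k) → All (λ φ → QGL⊢ ⟪ φ ⟫ ρ) φs → QGL⊢ ⟪ φs ⇒* ψ ⟫ ρ → QGL⊢ ⟪ ψ ⟫ ρ
  go [] [] d = d
  go (φ ∷ φs) (e ∷ es) d = go φs es (mp d e)

x₀ : ∀ {n} → Schema (suc n)
x₀ = at #0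
x₁ : ∀ {n} → Schema (suc (suc n))
x₁ = at (1+ #0)
x₂ : ∀ {n} → Schema (suc (suc (suc n)))
x₂ = at (1+ (1+ #0))
x₃ : ∀ {n} → Schema (suc (suc (suc (suc n))))
x₃ = at (1+ (1+ (1+ #0)))
x₄ : ∀ {n} → Schema (suc (suc (suc (suc (suc n)))))
x₄ = at (1+ (1+ (1+ (1+ #0))))
x₅ : ∀ {n} → Schema (suc (suc (suc (suc (suc (suc n))))))
x₅ = at (1+ (1+ (1+ (1+ (1+ #0)))))

rename-self : ∀ A x → A [ x / x ] ≡ A
rename-self top x = refl
rename-self bot x = refl
rename-self (neg A) x = cong neg (rename-self A x)
rename-self (A ⇒ B) x = cong₂ _⇒_ (rename-self A x) (rename-self B x)
rename-self (A ∨ᶠ B) x = cong₂ _∨ᶠ_ (rename-self A x) (rename-self B x)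
rename-self (A ∧ᶠ B) x = cong₂ _∧ᶠ_ (rename-self A x) (rename-self B x)
rename-self (all z A) x with z ≡ᵇ x
... | true = refl
... | false = cong (all z) (rename-self A x)
rename-self (ex z A) x with z ≡ᵇ x
... | true = refl
... | false = cong (ex z) (rename-self A x)
rename-self (box A) x = cong box (rename-self A x)
rename-self (pv j) x = refl
rename-self (rel k j xs) x = cong (rel k j) (trans (map-cong rename-var xs) (map-id xs))
  where
  rename-var : ∀ z → (if z ≡ᵇ x then x else z) ≡ z
  rename-var z with z ≡ᵇ x in eq
  ... | true = sym (≡ᵇ⇒≡ z x (subst T (sym eq) _))
  ... | false = refl

∉-all : ∀ {u A} → ¬ FreeIn u (all u A)
∉-all (all u≢u _) = u≢u refl

∉-ex : ∀ {u A} → ¬ FreeIn u (ex u A)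
∉-ex (ex u≢u _) = u≢u refl

freeFor-self : ∀ A x → FreeFor x x A
freeFor-self top x = _
freeFor-self bot x = _
freeFor-self (neg A) x = freeFor-self A x
freeFor-self (A ⇒ B) x = freeFor-self A x , freeFor-self B x
freeFor-self (A ∨ᶠ B) x = freeFor-self A x , freeFor-self B x
freeFor-self (A ∧ᶠ B) x = freeFor-self A x , freeFor-self B x
freeFor-self (all z A) x with z ≟ x
... | yes refl = inj₁ ∉-all
... | no z≢x = inj₂ (z≢x , freeFor-self A x)
freeFor-self (ex z A) x with z ≟ x
... | yes refl = inj₁ ∉-ex
... | no z≢x = inj₂ (z≢x , freeFor-self A x)
freeFor-self (box A) x = freeFor-self A x
freeFor-self (pv j) x = _
freeFor-self (rel k j xs) x = _

∀-elim : ∀ x A → QGL⊢ (all x A ⇒ A)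
∀-elim x A = subst (λ B → QGL⊢ (all x A ⇒ B)) (rename-self A x) (ax (∀-inst (freeFor-self A x)))

∃-intro : ∀ x A → QGL⊢ (A ⇒ ex x A)
∃-intro x A = subst (λ B → QGL⊢ (B ⇒ ex x A)) (rename-self A x) (ax (∃-intr (freeFor-self A x)))

⇔-intro : ∀ {H A B} → QGL⊢ (H ⇒ A ⇒ B) → QGL⊢ (H ⇒ B ⇒ A) → QGL⊢ (H ⇒ (A ⇔ B))
⇔-intro {H} {A} {B} d e = by-taut (x₀ ⇒ˢ x₁ ⇒ˢ x₂ ∷ x₀ ⇒ˢ x₂ ⇒ˢ x₁ ∷ []) (x₀ ⇒ˢ (x₁ ⇔ˢ x₂)) refl (H ∷ A ∷ B ∷ []) (d ∷ e ∷ [])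

⇔-elimˡ : ∀ {H A B} → QGL⊢ (H ⇒ (A ⇔ B)) → QGL⊢ (H ⇒ A ⇒ B)
⇔-elimˡ {H} {A} {B} d = by-taut (x₀ ⇒ˢ (x₁ ⇔ˢ x₂) ∷ []) (x₀ ⇒ˢ x₁ ⇒ˢ x₂) refl (H ∷ A ∷ B ∷ []) (d ∷ [])

⇔-elimʳ : ∀ {H A B} → QGL⊢ (H ⇒ (A ⇔ B)) → QGL⊢ (H ⇒ B ⇒ A)
⇔-elimʳ {H} {A} {B} d = by-taut (x₀ ⇒ˢ (x₁ ⇔ˢ x₂) ∷ []) (x₀ ⇒ˢ x₂ ⇒ˢ x₁) refl (H ∷ A ∷ B ∷ []) (d ∷ [])

∀-mono : ∀ {H A B} u → ¬ FreeIn u H → QGL⊢ (H ⇒ A ⇒ B) → QGL⊢ (H ⇒ all u A ⇒ all u B)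
∀-mono {H} {A} {B} u u∉H d =
  by-taut (x₀ ∧ˢ x₁ ⇒ˢ x₂ ∷ []) (x₀ ⇒ˢ x₁ ⇒ˢ x₂) refl (H ∷ all u A ∷ all u B ∷ [])
    (mp (ax (∀-ax λ { (∧ˡ u∈H) → u∉H u∈H ; (∧ʳ u∈∀A) → ∉-all u∈∀A }))
        (gen u (by-taut (x₀ ⇒ˢ x₁ ⇒ˢ x₂ ∷ x₃ ⇒ˢ x₁ ∷ []) (x₀ ∧ˢ x₃ ⇒ˢ x₂) refl
                        (H ∷ A ∷ B ∷ all u A ∷ []) (d ∷ ∀-elim u A ∷ []))) ∷ [])

∃-mono : ∀ {H A B} u → ¬ FreeIn u H → QGL⊢ (H ⇒ A ⇒ B) → QGL⊢ (H ⇒ ex u A ⇒ ex u B)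
∃-mono {H} {A} {B} u u∉H d =
  by-taut (x₁ ⇒ˢ x₀ ⇒ˢ x₂ ∷ []) (x₀ ⇒ˢ x₁ ⇒ˢ x₂) refl (H ∷ ex u A ∷ ex u B ∷ [])
    (mp (ax (∃-elim λ { (⇒ˡ u∈H) → u∉H u∈H ; (⇒ʳ u∈∃B) → ∉-ex u∈∃B }))
        (gen u (by-taut (x₀ ⇒ˢ x₁ ⇒ˢ x₂ ∷ x₂ ⇒ˢ x₃ ∷ []) (x₁ ⇒ˢ x₀ ⇒ˢ x₃) refl
                        (H ∷ A ∷ B ∷ ex u B ∷ []) (d ∷ ∃-intro u B ∷ []))) ∷ [])

∀-cong : ∀ {H A B} u → ¬ FreeIn u H → QGL⊢ (H ⇒ (A ⇔ B)) → QGL⊢ (H ⇒ (all u A ⇔ all u B))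
∀-cong u u∉H d = ⇔-intro (∀-mono u u∉H (⇔-elimˡ d)) (∀-mono u u∉H (⇔-elimʳ d))

∃-cong : ∀ {H A B} u → ¬ FreeIn u H → QGL⊢ (H ⇒ (A ⇔ B)) → QGL⊢ (H ⇒ (ex u A ⇔ ex u B))
∃-cong u u∉H d = ⇔-intro (∃-mono u u∉H (⇔-elimˡ d)) (∃-mono u u∉H (⇔-elimʳ d))

□-mono : ∀ {A B} → QGL⊢ (A ⇒ B) → QGL⊢ (box A ⇒ box B)
□-mono d = mp (ax K) (nec d)

□-∧ : ∀ A B → QGL⊢ (box A ⇒ box B ⇒ box (A ∧ᶠ B))
□-∧ A B = by-taut (x₀ ⇒ˢ x₂ ∷ x₂ ⇒ˢ x₁ ⇒ˢ x₃ ∷ []) (x₀ ⇒ˢ x₁ ⇒ˢ x₃) refl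
  (box A ∷ box B ∷ box (B ⇒ A ∧ᶠ B) ∷ box (A ∧ᶠ B) ∷ [])
  (□-mono (tautology (x₀ ⇒ˢ x₁ ⇒ˢ x₀ ∧ˢ x₁) refl (A ∷ B ∷ [])) ∷ ax K ∷ [])

□-⇔ : ∀ A B → QGL⊢ (box (A ⇔ B) ⇒ (box A ⇔ box B))
□-⇔ A B = ⇔-intro (□-mono⇒ (⇔-elimˡ (tautology (x₀ ⇒ˢ x₀) refl ((A ⇔ B) ∷ []))))
                  (□-mono⇒ (⇔-elimʳ (tautology (x₀ ⇒ˢ x₀) refl ((A ⇔ B) ∷ []))))
  where
  □-mono⇒ : ∀ {U V} → QGL⊢ ((A ⇔ B) ⇒ U ⇒ V) → QGL⊢ (box (A ⇔ B) ⇒ box U ⇒ box V)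
  □-mono⇒ {U} {V} d = by-taut (x₀ ⇒ˢ x₃ ∷ x₃ ⇒ˢ x₁ ⇒ˢ x₂ ∷ []) (x₀ ⇒ˢ x₁ ⇒ˢ x₂) refl
    (box (A ⇔ B) ∷ box U ∷ box V ∷ box (U ⇒ V) ∷ []) (□-mono d ∷ ax K ∷ [])

Σ⇒□ : ∀ {A} → IsΣ A → QGL⊢ (A ⇒ box A)
Σ⇒□ box = ax four
Σ⇒□ (or {B} {C} σB σC) =
  by-taut (x₀ ⇒ˢ x₂ ∷ x₁ ⇒ˢ x₃ ∷ x₂ ⇒ˢ x₄ ∷ x₃ ⇒ˢ x₄ ∷ []) (x₀ ∨ˢ x₁ ⇒ˢ x₄) refl
    (B ∷ C ∷ box B ∷ box C ∷ box (B ∨ᶠ C) ∷ [])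
    (Σ⇒□ σB ∷ Σ⇒□ σC ∷ □-mono (tautology (x₀ ⇒ˢ x₀ ∨ˢ x₁) refl (B ∷ C ∷ []))
                      ∷ □-mono (tautology (x₁ ⇒ˢ x₀ ∨ˢ x₁) refl (B ∷ C ∷ [])) ∷ [])
Σ⇒□ (and {B} {C} σB σC) =
  by-taut (x₀ ⇒ˢ x₂ ∷ x₁ ⇒ˢ x₃ ∷ x₂ ⇒ˢ x₃ ⇒ˢ x₄ ∷ []) (x₀ ∧ˢ x₁ ⇒ˢ x₄) refl
    (B ∷ C ∷ box B ∷ box C ∷ box (B ∧ᶠ C) ∷ [])
    (Σ⇒□ σB ∷ Σ⇒□ σC ∷ □-∧ B C ∷ [])
Σ⇒□ (ex {u} {B} σB) =
  mp (ax (∃-elim λ { (box u∈∃B) → ∉-ex u∈∃B }))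
     (gen u (by-taut (x₀ ⇒ˢ x₁ ∷ x₁ ⇒ˢ x₂ ∷ []) (x₀ ⇒ˢ x₂) refl (B ∷ box B ∷ box (ex u B) ∷ [])
                     (Σ⇒□ σB ∷ □-mono (∃-intro u B) ∷ [])))

_[_↦_] : (ℕ → Form) → ℕ → Form → ℕ → Form
(σ [ m ↦ X ]) j = if j ≡ᵇ m then X else σ j

[↦]-here : ∀ σ m X → (σ [ m ↦ X ]) m ≡ X
[↦]-here σ m X with m ≡ᵇ m in eq
... | true = refl
... | false = ⊥-elim (subst T eq (≡⇒≡ᵇ m m refl))

[↦]-there : ∀ σ {m} X {j} → j ≢ m → (σ [ m ↦ X ]) j ≡ σ j
[↦]-there σ {m} X {j} j≢m with j ≡ᵇ m in eq
... | true = ⊥-elim (j≢m (≡ᵇ⇒≡ j m (subst T (sym eq) _)))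
... | false = refl

substP-cong : ∀ {σ τ} A → (∀ {j} → PvIn j A → σ j ≡ τ j) → substP σ A ≡ substP τ A
substP-cong top e = refl
substP-cong bot e = refl
substP-cong (neg A) e = cong neg (substP-cong A (e ∘ neg))
substP-cong (A ⇒ B) e = cong₂ _⇒_ (substP-cong A (e ∘ ⇒ˡ)) (substP-cong B (e ∘ ⇒ʳ))
substP-cong (A ∨ᶠ B) e = cong₂ _∨ᶠ_ (substP-cong A (e ∘ ∨ˡ)) (substP-cong B (e ∘ ∨ʳ))
substP-cong (A ∧ᶠ B) e = cong₂ _∧ᶠ_ (substP-cong A (e ∘ ∧ˡ)) (substP-cong B (e ∘ ∧ʳ))
substP-cong (all x A) e = cong (all x) (substP-cong A (e ∘ all))
substP-cong (ex x A) e = cong (ex x) (substP-cong A (e ∘ ex))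
substP-cong (box A) e = cong box (substP-cong A (e ∘ box))
substP-cong (pv j) e = e here
substP-cong (rel k j xs) e = refl

substP-pv : ∀ A → substP pv A ≡ A
substP-pv top = refl
substP-pv bot = refl
substP-pv (neg A) = cong neg (substP-pv A)
substP-pv (A ⇒ B) = cong₂ _⇒_ (substP-pv A) (substP-pv B)
substP-pv (A ∨ᶠ B) = cong₂ _∨ᶠ_ (substP-pv A) (substP-pv B)
substP-pv (A ∧ᶠ B) = cong₂ _∧ᶠ_ (substP-pv A) (substP-pv B)
substP-pv (all x A) = cong (all x) (substP-pv A)
substP-pv (ex x A) = cong (ex x) (substP-pv A)
substP-pv (box A) = cong box (substP-pv A)
substP-pv (pv j) = refl
substP-pv (rel k j xs) = refl

substP-identity : ∀ σ A → (∀ {j} → PvIn j A → σ j ≡ pv j) → substP σ A ≡ A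
substP-identity σ A e = trans (substP-cong A e) (substP-pv A)

substP-∘ : ∀ σ τ A → substP σ (substP τ A) ≡ substP (substP σ ∘ τ) A
substP-∘ σ τ top = refl
substP-∘ σ τ bot = refl
substP-∘ σ τ (neg A) = cong neg (substP-∘ σ τ A)
substP-∘ σ τ (A ⇒ B) = cong₂ _⇒_ (substP-∘ σ τ A) (substP-∘ σ τ B)
substP-∘ σ τ (A ∨ᶠ B) = cong₂ _∨ᶠ_ (substP-∘ σ τ A) (substP-∘ σ τ B)
substP-∘ σ τ (A ∧ᶠ B) = cong₂ _∧ᶠ_ (substP-∘ σ τ A) (substP-∘ σ τ B)
substP-∘ σ τ (all x A) = cong (all x) (substP-∘ σ τ A)
substP-∘ σ τ (ex x A) = cong (ex x) (substP-∘ σ τ A)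
substP-∘ σ τ (box A) = cong box (substP-∘ σ τ A)
substP-∘ σ τ (pv j) = refl
substP-∘ σ τ (rel k j xs) = refl

IsΣ-substP : ∀ σ {A} → IsΣ A → IsΣ (substP σ A)
IsΣ-substP σ box = box
IsΣ-substP σ (or σB σC) = or (IsΣ-substP σ σB) (IsΣ-substP σ σC)
IsΣ-substP σ (and σB σC) = and (IsΣ-substP σ σB) (IsΣ-substP σ σC)
IsΣ-substP σ (ex σB) = ex (IsΣ-substP σ σB)

private
  under : ∀ {P Q : Set} {R : ℕ → Set} {A B} → (P → Q) → (∀ {j} → PvIn j A → PvIn j B) →
          P ⊎ ∃ (λ j → PvIn j A × R j) → Q ⊎ ∃ (λ j → PvIn j B × R j)
  under f g = Sum.map f (Prod.map₂ (Prod.map₁ g))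

FreeIn-substP : ∀ σ A {x} → FreeIn x (substP σ A) → FreeIn x A ⊎ ∃ λ j → PvIn j A × FreeIn x (σ j)
FreeIn-substP σ (neg A) (neg f) = under neg neg (FreeIn-substP σ A f)
FreeIn-substP σ (A ⇒ B) (⇒ˡ f) = under ⇒ˡ ⇒ˡ (FreeIn-substP σ A f)
FreeIn-substP σ (A ⇒ B) (⇒ʳ f) = under ⇒ʳ ⇒ʳ (FreeIn-substP σ B f)
FreeIn-substP σ (A ∨ᶠ B) (∨ˡ f) = under ∨ˡ ∨ˡ (FreeIn-substP σ A f)
FreeIn-substP σ (A ∨ᶠ B) (∨ʳ f) = under ∨ʳ ∨ʳ (FreeIn-substP σ B f)
FreeIn-substP σ (A ∧ᶠ B) (∧ˡ f) = under ∧ˡ ∧ˡ (FreeIn-substP σ A f)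
FreeIn-substP σ (A ∧ᶠ B) (∧ʳ f) = under ∧ʳ ∧ʳ (FreeIn-substP σ B f)
FreeIn-substP σ (all y A) (all y≢x f) = under (all y≢x) all (FreeIn-substP σ A f)
FreeIn-substP σ (ex y A) (ex y≢x f) = under (ex y≢x) ex (FreeIn-substP σ A f)
FreeIn-substP σ (box A) (box f) = under box box (FreeIn-substP σ A f)
FreeIn-substP σ (pv j) f = inj₂ (j , here , f)
FreeIn-substP σ (rel k j xs) f = inj₁ f

BoundIn-substP : ∀ σ A {x} → BoundIn x (substP σ A) → BoundIn x A ⊎ ∃ λ j → PvIn j A × BoundIn x (σ j)
BoundIn-substP σ (neg A) (neg b) = under neg neg (BoundIn-substP σ A b)
BoundIn-substP σ (A ⇒ B) (⇒ˡ b) = under ⇒ˡ ⇒ˡ (BoundIn-substP σ A b)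
BoundIn-substP σ (A ⇒ B) (⇒ʳ b) = under ⇒ʳ ⇒ʳ (BoundIn-substP σ B b)
BoundIn-substP σ (A ∨ᶠ B) (∨ˡ b) = under ∨ˡ ∨ˡ (BoundIn-substP σ A b)
BoundIn-substP σ (A ∨ᶠ B) (∨ʳ b) = under ∨ʳ ∨ʳ (BoundIn-substP σ B b)
BoundIn-substP σ (A ∧ᶠ B) (∧ˡ b) = under ∧ˡ ∧ˡ (BoundIn-substP σ A b)
BoundIn-substP σ (A ∧ᶠ B) (∧ʳ b) = under ∧ʳ ∧ʳ (BoundIn-substP σ B b)
BoundIn-substP σ (all y A) allₕ = inj₁ allₕ
BoundIn-substP σ (all y A) (all b) = under all all (BoundIn-substP σ A b)
BoundIn-substP σ (ex y A) exₕ = inj₁ exₕ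
BoundIn-substP σ (ex y A) (ex b) = under ex ex (BoundIn-substP σ A b)
BoundIn-substP σ (box A) (box b) = under box box (BoundIn-substP σ A b)
BoundIn-substP σ (pv j) b = inj₂ (j , here , b)

PredIn-substP : ∀ σ A {k i} → PredIn k i (substP σ A) → PredIn k i A ⊎ ∃ λ j → PvIn j A × PredIn k i (σ j)
PredIn-substP σ (neg A) (neg q) = under neg neg (PredIn-substP σ A q)
PredIn-substP σ (A ⇒ B) (⇒ˡ q) = under ⇒ˡ ⇒ˡ (PredIn-substP σ A q)
PredIn-substP σ (A ⇒ B) (⇒ʳ q) = under ⇒ʳ ⇒ʳ (PredIn-substP σ B q)
PredIn-substP σ (A ∨ᶠ B) (∨ˡ q) = under ∨ˡ ∨ˡ (PredIn-substP σ A q)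
PredIn-substP σ (A ∨ᶠ B) (∨ʳ q) = under ∨ʳ ∨ʳ (PredIn-substP σ B q)
PredIn-substP σ (A ∧ᶠ B) (∧ˡ q) = under ∧ˡ ∧ˡ (PredIn-substP σ A q)
PredIn-substP σ (A ∧ᶠ B) (∧ʳ q) = under ∧ʳ ∧ʳ (PredIn-substP σ B q)
PredIn-substP σ (all y A) (all q) = under all all (PredIn-substP σ A q)
PredIn-substP σ (ex y A) (ex q) = under ex ex (PredIn-substP σ A q)
PredIn-substP σ (box A) (box q) = under box box (PredIn-substP σ A q)
PredIn-substP σ (pv j) q = inj₂ (j , here , q)
PredIn-substP σ (rel k j xs) q = inj₁ q

PvIn-substP : ∀ σ A {p} → PvIn p (substP σ A) → ∃ λ j → PvIn j A × PvIn p (σ j)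
PvIn-substP σ (neg A) (neg q) = Prod.map₂ (Prod.map₁ neg) (PvIn-substP σ A q)
PvIn-substP σ (A ⇒ B) (⇒ˡ q) = Prod.map₂ (Prod.map₁ ⇒ˡ) (PvIn-substP σ A q)
PvIn-substP σ (A ⇒ B) (⇒ʳ q) = Prod.map₂ (Prod.map₁ ⇒ʳ) (PvIn-substP σ B q)
PvIn-substP σ (A ∨ᶠ B) (∨ˡ q) = Prod.map₂ (Prod.map₁ ∨ˡ) (PvIn-substP σ A q)
PvIn-substP σ (A ∨ᶠ B) (∨ʳ q) = Prod.map₂ (Prod.map₁ ∨ʳ) (PvIn-substP σ B q)
PvIn-substP σ (A ∧ᶠ B) (∧ˡ q) = Prod.map₂ (Prod.map₁ ∧ˡ) (PvIn-substP σ A q)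
PvIn-substP σ (A ∧ᶠ B) (∧ʳ q) = Prod.map₂ (Prod.map₁ ∧ʳ) (PvIn-substP σ B q)
PvIn-substP σ (all y A) (all q) = Prod.map₂ (Prod.map₁ all) (PvIn-substP σ A q)
PvIn-substP σ (ex y A) (ex q) = Prod.map₂ (Prod.map₁ ex) (PvIn-substP σ A q)
PvIn-substP σ (box A) (box q) = Prod.map₂ (Prod.map₁ box) (PvIn-substP σ A q)
PvIn-substP σ (pv j) q = j , here , q

module _ {H : Form} (H⇒□H : QGL⊢ (H ⇒ box H))
         {σ τ : ℕ → Form} (σ⇔τ : ∀ j → QGL⊢ (H ⇒ (σ j ⇔ τ j))) where

  ⇔-substP : ∀ A → (∀ {x} → BoundIn x A → ¬ FreeIn x H) → QGL⊢ (H ⇒ (substP σ A ⇔ substP τ A))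
  ⇔-substP top _ = tautology (x₀ ⇒ˢ (x₁ ⇔ˢ x₁)) refl (H ∷ top ∷ [])
  ⇔-substP bot _ = tautology (x₀ ⇒ˢ (x₁ ⇔ˢ x₁)) refl (H ∷ bot ∷ [])
  ⇔-substP (rel k j xs) _ = tautology (x₀ ⇒ˢ (x₁ ⇔ˢ x₁)) refl (H ∷ rel k j xs ∷ [])
  ⇔-substP (pv j) _ = σ⇔τ j
  ⇔-substP (neg A) c =
    by-taut (x₀ ⇒ˢ (x₁ ⇔ˢ x₂) ∷ []) (x₀ ⇒ˢ (¬ˢ x₁ ⇔ˢ ¬ˢ x₂)) refl
      (H ∷ substP σ A ∷ substP τ A ∷ []) (⇔-substP A (c ∘ neg) ∷ [])
  ⇔-substP (A ⇒ B) c =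
    by-taut (x₀ ⇒ˢ (x₁ ⇔ˢ x₂) ∷ x₀ ⇒ˢ (x₃ ⇔ˢ x₄) ∷ []) (x₀ ⇒ˢ (x₁ ⇒ˢ x₃ ⇔ˢ x₂ ⇒ˢ x₄)) refl
      (H ∷ substP σ A ∷ substP τ A ∷ substP σ B ∷ substP τ B ∷ [])
      (⇔-substP A (c ∘ ⇒ˡ) ∷ ⇔-substP B (c ∘ ⇒ʳ) ∷ [])
  ⇔-substP (A ∨ᶠ B) c =
    by-taut (x₀ ⇒ˢ (x₁ ⇔ˢ x₂) ∷ x₀ ⇒ˢ (x₃ ⇔ˢ x₄) ∷ []) (x₀ ⇒ˢ (x₁ ∨ˢ x₃ ⇔ˢ x₂ ∨ˢ x₄)) refl
      (H ∷ substP σ A ∷ substP τ A ∷ substP σ B ∷ substP τ B ∷ [])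
      (⇔-substP A (c ∘ ∨ˡ) ∷ ⇔-substP B (c ∘ ∨ʳ) ∷ [])
  ⇔-substP (A ∧ᶠ B) c =
    by-taut (x₀ ⇒ˢ (x₁ ⇔ˢ x₂) ∷ x₀ ⇒ˢ (x₃ ⇔ˢ x₄) ∷ []) (x₀ ⇒ˢ (x₁ ∧ˢ x₃ ⇔ˢ x₂ ∧ˢ x₄)) refl
      (H ∷ substP σ A ∷ substP τ A ∷ substP σ B ∷ substP τ B ∷ [])
      (⇔-substP A (c ∘ ∧ˡ) ∷ ⇔-substP B (c ∘ ∧ʳ) ∷ [])
  ⇔-substP (all y A) c = ∀-cong y (c allₕ) (⇔-substP A (c ∘ all))
  ⇔-substP (ex y A) c = ∃-cong y (c exₕ) (⇔-substP A (c ∘ ex))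
  ⇔-substP (box A) c =
    by-taut (x₀ ⇒ˢ x₁ ∷ x₁ ⇒ˢ x₂ ∷ x₂ ⇒ˢ x₃ ∷ []) (x₀ ⇒ˢ x₃) refl
      (H ∷ box H ∷ box (substP σ A ⇔ substP τ A) ∷ (box (substP σ A) ⇔ box (substP τ A)) ∷ [])
      (H⇒□H ∷ □-mono (⇔-substP A (c ∘ box)) ∷ □-⇔ _ _ ∷ [])

  -- In a Σ-formula every propositional variable lies under a box, so □H suffices.
  ⇔-substPΣ : ∀ {A} → IsΣ A → (∀ {x} → BoundIn x A → ¬ FreeIn x H) → QGL⊢ (box H ⇒ (substP σ A ⇔ substP τ A))
  ⇔-substPΣ (box {A}) c =
    by-taut (x₀ ⇒ˢ x₁ ∷ x₁ ⇒ˢ x₂ ∷ []) (x₀ ⇒ˢ x₂) refl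
      (box H ∷ box (substP σ A ⇔ substP τ A) ∷ (box (substP σ A) ⇔ box (substP τ A)) ∷ [])
      (□-mono (⇔-substP A (c ∘ box)) ∷ □-⇔ _ _ ∷ [])
  ⇔-substPΣ (or {A} {B} σA σB) c =
    by-taut (x₀ ⇒ˢ (x₁ ⇔ˢ x₂) ∷ x₀ ⇒ˢ (x₃ ⇔ˢ x₄) ∷ []) (x₀ ⇒ˢ (x₁ ∨ˢ x₃ ⇔ˢ x₂ ∨ˢ x₄)) refl
      (box H ∷ substP σ A ∷ substP τ A ∷ substP σ B ∷ substP τ B ∷ [])
      (⇔-substPΣ σA (c ∘ ∨ˡ) ∷ ⇔-substPΣ σB (c ∘ ∨ʳ) ∷ [])
  ⇔-substPΣ (and {A} {B} σA σB) c =
    by-taut (x₀ ⇒ˢ (x₁ ⇔ˢ x₂) ∷ x₀ ⇒ˢ (x₃ ⇔ˢ x₄) ∷ []) (x₀ ⇒ˢ (x₁ ∧ˢ x₃ ⇔ˢ x₂ ∧ˢ x₄)) refl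
      (box H ∷ substP σ A ∷ substP τ A ∷ substP σ B ∷ substP τ B ∷ [])
      (⇔-substPΣ σA (c ∘ ∧ˡ) ∷ ⇔-substPΣ σB (c ∘ ∧ʳ) ∷ [])
  ⇔-substPΣ (ex {u} σA) c = ∃-cong u (λ { (box u∈H) → c exₕ u∈H }) (⇔-substPΣ σA (c ∘ ex))

[↦]-⇔ : ∀ {H X Y} m → QGL⊢ (H ⇒ (X ⇔ Y)) → ∀ j → QGL⊢ (H ⇒ ((pv [ m ↦ X ]) j ⇔ (pv [ m ↦ Y ]) j))
[↦]-⇔ {H} m d j with j ≡ᵇ m
... | true = d
... | false = tautology (x₀ ⇒ˢ (x₁ ⇔ˢ x₁)) refl (H ∷ pv j ∷ [])

FreeIn-[↦top] : ∀ m {x} A → FreeIn x (substP (pv [ m ↦ top ]) A) → FreeIn x A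
FreeIn-[↦top] m A f with FreeIn-substP (pv [ m ↦ top ]) A f
... | inj₁ f′ = f′
... | inj₂ (j , _ , f′) with j ≡ᵇ m | f′
... | true | ()
... | false | ()

Σ-fixpoint : ∀ m {T} → IsΣ T → (∀ {x} → BoundIn x T → ¬ FreeIn x T) →
             QGL⊢ (substP (pv [ m ↦ top ]) T ⇔ substP (pv [ m ↦ substP (pv [ m ↦ top ]) T ]) T)
Σ-fixpoint m {T} ΣT closed = mp □E⇒E (mp (ax löb) (nec □E⇒E))
  where
  G TG : Form
  G = substP (pv [ m ↦ top ]) T
  TG = substP (pv [ m ↦ G ]) T
  G⇒□G : QGL⊢ (G ⇒ box G)
  G⇒□G = Σ⇒□ (IsΣ-substP _ ΣT)
  H⇒□H : QGL⊢ (G ∧ᶠ box G ⇒ box (G ∧ᶠ box G))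
  H⇒□H = by-taut (x₀ ⇒ˢ x₁ ∷ x₁ ⇒ˢ x₂ ∷ x₁ ⇒ˢ x₂ ⇒ˢ x₃ ∷ []) (x₀ ∧ˢ x₁ ⇒ˢ x₃) refl
           (G ∷ box G ∷ box (box G) ∷ box (G ∧ᶠ box G) ∷ []) (G⇒□G ∷ ax four ∷ □-∧ G (box G) ∷ [])
  H⇒G⇔⊤ : QGL⊢ (G ∧ᶠ box G ⇒ (G ⇔ top))
  H⇒G⇔⊤ = tautology (x₀ ∧ˢ x₁ ⇒ˢ (x₀ ⇔ˢ ⊤ˢ)) refl (G ∷ box G ∷ [])
  closedH : ∀ {x} → BoundIn x T → ¬ FreeIn x (G ∧ᶠ box G)
  closedH b (∧ˡ f) = closed b (FreeIn-[↦top] m T f)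
  closedH b (∧ʳ (box f)) = closed b (FreeIn-[↦top] m T f)
  □G⇒TG⇔G : QGL⊢ (box G ⇒ (TG ⇔ G))
  □G⇒TG⇔G = by-taut (x₀ ⇒ˢ x₁ ∷ x₀ ⇒ˢ x₁ ⇒ˢ x₂ ∷ x₂ ⇒ˢ (x₃ ⇔ˢ x₄) ∷ []) (x₀ ⇒ˢ (x₃ ⇔ˢ x₄)) refl
              (box G ∷ box (box G) ∷ box (G ∧ᶠ box G) ∷ TG ∷ G ∷ [])
              (ax four ∷ □-∧ G (box G) ∷ ⇔-substPΣ H⇒□H ([↦]-⇔ m H⇒G⇔⊤) ΣT closedH ∷ [])
  □E⇒E : QGL⊢ (box (G ⇔ TG) ⇒ (G ⇔ TG))
  □E⇒E = by-taut (x₀ ⇒ˢ x₁ ∷ x₂ ⇒ˢ x₃ ∷ x₁ ⇒ˢ (x₂ ⇔ˢ x₀) ∷ x₄ ⇒ˢ x₅ ∷ x₅ ⇒ˢ x₃ ⇒ˢ x₁ ∷ [])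
           (x₄ ⇒ˢ (x₀ ⇔ˢ x₂)) refl
           (G ∷ box G ∷ TG ∷ box TG ∷ box (G ⇔ TG) ∷ box (TG ⇒ G) ∷ [])
           (G⇒□G ∷ Σ⇒□ (IsΣ-substP _ ΣT) ∷ □G⇒TG⇔G
             ∷ □-mono (tautology ((x₀ ⇔ˢ x₁) ⇒ˢ x₁ ⇒ˢ x₀) refl (G ∷ TG ∷ [])) ∷ ax K ∷ [])

substP-[↦] : ∀ τ m Y j → substP τ ((pv [ m ↦ Y ]) j) ≡ (τ [ m ↦ substP τ Y ]) j
substP-[↦] τ m Y j with j ≡ᵇ m
... | true = refl
... | false = refl

[↦]-substP : ∀ {τ m} X → τ m ≡ pv m → (∀ {j} → j ≢ m → ¬ PvIn m (τ j)) →
             ∀ j → substP (pv [ m ↦ X ]) (τ j) ≡ (τ [ m ↦ X ]) j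
[↦]-substP {τ} {m} X τm m∉τ j with j ≟ m
... | yes refl = trans (cong (substP (pv [ m ↦ X ])) τm) (trans ([↦]-here pv m X) (sym ([↦]-here τ m X)))
... | no j≢m = trans (substP-identity _ (τ j) (λ {i} i∈τj → [↦]-there pv X λ { refl → m∉τ j≢m i∈τj }))
                     (sym ([↦]-there τ X j≢m))

tupleℕ : ℕ → (ℕ → Form) → ℕ → Form
tupleℕ N F j with j <? N
... | yes _ = F j
... | no _ = pv j

tupleℕ-< : ∀ {N} F {j} → j < N → tupleℕ N F j ≡ F j
tupleℕ-< {N} F {j} j<N with j <? N
... | yes _ = refl
... | no j≮N = ⊥-elim (j≮N j<N)

tupleℕ-≮ : ∀ {N} F {j} → ¬ j < N → tupleℕ N F j ≡ pv j
tupleℕ-≮ {N} F {j} j≮N with j <? N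
... | yes j<N = ⊥-elim (j≮N j<N)
... | no _ = refl

module Fixpoints (Pred : ℕ → ℕ → Set) (Free Bound : Var → Set)
                 (bound∉free : ∀ {x} → Bound x → ¬ Free x) where

  record Within (V : ℕ → Set) (A : Form) : Set where
    field
      preds  : ∀ {k j} → PredIn k j A → Pred k j
      pvars  : ∀ {p} → PvIn p A → V p
      frees  : ∀ {x} → FreeIn x A → Free x
      bounds : ∀ {x} → BoundIn x A → Bound x
  open Within public

  Within-mono : ∀ {V W A} → (∀ {p} → V p → W p) → Within V A → Within W A
  Within-mono V⊆W WA = record { preds = preds WA ; pvars = V⊆W ∘ pvars WA ; frees = frees WA ; bounds = bounds WA }

  Within-top : ∀ {V} → Within V top
  Within-top = record { preds = λ () ; pvars = λ () ; frees = λ () ; bounds = λ () }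

  Within-pv : ∀ {V p} → V p → Within V (pv p)
  Within-pv v = record { preds = λ () ; pvars = λ { here → v } ; frees = λ () ; bounds = λ () }

  Within-substP : ∀ {V W σ A} → Within V A → (∀ {j} → PvIn j A → Within W (σ j)) → Within W (substP σ A)
  Within-substP {σ = σ} {A} WA Wσ = record
    { preds  = λ q → [ preds WA , (λ (_ , j∈A , q′) → preds (Wσ j∈A) q′) ]′ (PredIn-substP σ A q)
    ; pvars  = λ q → let (_ , j∈A , q′) = PvIn-substP σ A q in pvars (Wσ j∈A) q′
    ; frees  = λ f → [ frees WA , (λ (_ , j∈A , f′) → frees (Wσ j∈A) f′) ]′ (FreeIn-substP σ A f)
    ; bounds = λ b → [ bounds WA , (λ (_ , j∈A , b′) → bounds (Wσ j∈A) b′) ]′ (BoundIn-substP σ A b)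
    }

  Within-closed : ∀ {V A} → Within V A → ∀ {x} → BoundIn x A → ¬ FreeIn x A
  Within-closed WA b f = bound∉free (bounds WA b) (frees WA f)

  _∖_ : (ℕ → Set) → ℕ → ℕ → Set
  (V ∖ m) p = V p × p ≢ m

  _∩≥_ : (ℕ → Set) → ℕ → ℕ → Set
  (V ∩≥ m) p = V p × m ≤ p

  Within-[↦] : ∀ {V A X} m → Within V A → Within (V ∖ m) X → Within (V ∖ m) (substP (pv [ m ↦ X ]) A)
  Within-[↦] {V} {A} {X} m WA WX = Within-substP WA Wσ
    where
    Wσ : ∀ {j} → PvIn j A → Within (V ∖ m) ((pv [ m ↦ X ]) j)
    Wσ {j} j∈A with j ≟ m
    ... | yes refl = subst (Within _) (sym ([↦]-here pv m X)) WX
    ... | no j≢m = subst (Within _) (sym ([↦]-there pv X j≢m)) (Within-pv (pvars WA j∈A , j≢m))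

  Solution : ℕ → (ℕ → Set) → (ℕ → Form) → Set
  Solution N V S = Σ (ℕ → Form) λ F →
    ∀ i → i < N → Within (V ∩≥ N) (F i) × QGL⊢ (F i ⇔ substP (tupleℕ N F) (S i))

  module Eliminate (N : ℕ) {V : ℕ → Set} (S : ℕ → Form)
                   (ΣS : ∀ i → i < suc N → IsΣ (S i)) (WS : ∀ i → i < suc N → Within V (S i)) where

    G′ : Form
    G′ = substP (pv [ N ↦ top ]) (S N)

    S′ : ℕ → Form
    S′ i = substP (pv [ N ↦ G′ ]) (S i)

    W-G′ : Within (V ∖ N) G′
    W-G′ = Within-[↦] N (WS N ≤-refl) Within-top

    ΣS′ : ∀ i → i < N → IsΣ (S′ i)
    ΣS′ i i<N = IsΣ-substP _ (ΣS i (m<n⇒m<1+n i<N))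

    WS′ : ∀ i → i < N → Within (V ∖ N) (S′ i)
    WS′ i i<N = Within-[↦] N (WS i (m<n⇒m<1+n i<N)) W-G′

    extend : Solution N (V ∖ N) S′ → Solution (suc N) V S
    extend (F′ , sol′) = F , solves
      where
      τ : ℕ → Form
      τ = tupleℕ N F′
      FN : Form
      FN = substP τ G′
      F : ℕ → Form
      F = τ [ N ↦ FN ]

      ∩≥-suc : ∀ {p} → ((V ∖ N) ∩≥ N) p → (V ∩≥ suc N) p
      ∩≥-suc ((v , p≢N) , N≤p) = v , ≤∧≢⇒< N≤p (p≢N ∘ sym)

      W-τ : ∀ {U j} → (∀ i → i < N → Within U (F′ i)) → (¬ j < N → U j) → Within U (τ j)
      W-τ {j = j} WF′ U-j with j <? N
      ... | yes j<N = WF′ j j<N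
      ... | no j≮N = Within-pv (U-j j≮N)

      τN : τ N ≡ pv N
      τN = tupleℕ-≮ F′ (<-irrefl refl)

      N∉τ : ∀ {j} → j ≢ N → ¬ PvIn N (τ j)
      N∉τ {j} j≢N N∈τj with j <? N
      N∉τ {j} j≢N N∈τj | yes j<N = proj₂ (proj₁ (pvars (proj₁ (sol′ j j<N)) N∈τj)) refl
      N∉τ {j} j≢N here | no _ = j≢N refl

      F-closed : ∀ A → substP F A ≡ substP (tupleℕ (suc N) F) A
      F-closed A = substP-cong A λ {j} _ → F-fixes j
        where
        F-fixes : ∀ j → F j ≡ tupleℕ (suc N) F j
        F-fixes j with j <? suc N
        ... | yes _ = refl
        ... | no j≮1+N = trans ([↦]-there τ FN j≢N) (tupleℕ-≮ F′ (j≮1+N ∘ m<n⇒m<1+n))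
          where
          j≢N : j ≢ N
          j≢N refl = j≮1+N ≤-refl

      T′ : Form
      T′ = substP τ (S N)

      substP-T′ : ∀ X → substP (pv [ N ↦ X ]) T′ ≡ substP (τ [ N ↦ X ]) (S N)
      substP-T′ X = trans (substP-∘ _ τ (S N)) (substP-cong (S N) λ {j} _ → [↦]-substP X τN N∉τ j)

      FN≡T′⊤ : FN ≡ substP (pv [ N ↦ top ]) T′
      FN≡T′⊤ = trans (substP-∘ τ _ (S N))
                     (trans (substP-cong (S N) (λ {j} _ → substP-[↦] τ N top j)) (sym (substP-T′ top)))

      W-T′ : Within (λ _ → ⊤) T′
      W-T′ = Within-substP (WS N ≤-refl) λ _ → W-τ (λ i i<N → Within-mono _ (proj₁ (sol′ i i<N))) _

      fixN : QGL⊢ (FN ⇔ substP F (S N))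
      fixN = subst₂ (λ A B → QGL⊢ (A ⇔ B)) (sym FN≡T′⊤)
               (trans (cong (λ Z → substP (pv [ N ↦ Z ]) T′) (sym FN≡T′⊤)) (substP-T′ FN))
               (Σ-fixpoint N (IsΣ-substP τ (ΣS N ≤-refl)) (Within-closed W-T′))

      W-FN : Within (V ∩≥ suc N) FN
      W-FN = Within-substP W-G′ λ j∈G′ →
        W-τ (λ i i<N → Within-mono ∩≥-suc (proj₁ (sol′ i i<N)))
            (λ j≮N → let (v , j≢N) = pvars W-G′ j∈G′ in v , ≤∧≢⇒< (≮⇒≥ j≮N) (j≢N ∘ sym))

      S′-solved : ∀ i → substP τ (S′ i) ≡ substP F (S i)
      S′-solved i = trans (substP-∘ τ _ (S i)) (substP-cong (S i) λ {j} _ → substP-[↦] τ N G′ j)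

      solves : ∀ i → i < suc N → Within (V ∩≥ suc N) (F i) × QGL⊢ (F i ⇔ substP (tupleℕ (suc N) F) (S i))
      solves i i<1+N with i ≟ N
      ... | yes refl = subst Solved (sym ([↦]-here τ N FN)) (W-FN , subst (λ B → QGL⊢ (FN ⇔ B)) (F-closed (S N)) fixN)
        where Solved = λ Z → Within (V ∩≥ suc N) Z × QGL⊢ (Z ⇔ substP (tupleℕ (suc N) F) (S N))
      ... | no i≢N = subst Solved (sym Fi≡F′i)
                       (Within-mono ∩≥-suc (proj₁ (sol′ i i<N)) ,
                        subst (λ B → QGL⊢ (F′ i ⇔ B)) (trans (S′-solved i) (F-closed (S i))) (proj₂ (sol′ i i<N)))
        where
        Solved = λ Z → Within (V ∩≥ suc N) Z × QGL⊢ (Z ⇔ substP (tupleℕ (suc N) F) (S i))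
        i<N : i < N
        i<N = ≤∧≢⇒< (s≤s⁻¹ i<1+N) i≢N
        Fi≡F′i : F i ≡ F′ i
        Fi≡F′i = trans ([↦]-there τ FN i≢N) (tupleℕ-< F′ i<N)

  fixpoints : ∀ N {V} (S : ℕ → Form) → (∀ i → i < N → IsΣ (S i)) → (∀ i → i < N → Within V (S i)) →
              Solution N V S
  fixpoints zero S _ _ = (λ _ → top) , λ _ ()
  fixpoints (suc N) S ΣS WS = extend (fixpoints N S′ ΣS′ WS′)
    where open Eliminate N S ΣS WS

tuple-< : ∀ {n} (S : Fin (suc n) → Form) {j} → j < suc n → ∃ λ l → tuple S j ≡ S l
tuple-< {n} S {j} j<1+n with j <? suc n
... | yes j<1+n′ = fromℕ< j<1+n′ , refl
... | no j≮1+n = ⊥-elim (j≮1+n j<1+n)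

tuple-toℕ : ∀ {n} (S : Fin (suc n) → Form) i → tuple S (toℕ i) ≡ S i
tuple-toℕ {n} S i with toℕ i <? suc n
... | yes i<1+n = cong S (fromℕ<-toℕ i i<1+n)
... | no i≮1+n = ⊥-elim (i≮1+n (toℕ<n i))

tupleℕ-toℕ : ∀ {n} F j → tupleℕ (suc n) F j ≡ tuple {n} (F ∘ toℕ) j
tupleℕ-toℕ {n} F j with j <? suc n
... | yes j<1+n = cong F (sym (toℕ-fromℕ< j<1+n))
... | no _ = refl

lemma6p7 : (n : ℕ) (S : Fin (suc n) → Form) →
    (∀ i → IsΣ (S i)) →
    (∀ i j x → BoundIn x (S i) → ¬ FreeIn x (S j)) →
    Σ (Fin (suc n) → Form) λ F →
      (∀ i →
        (∀ k j → PredIn k j (F i) → ∃ λ l → PredIn k j (S l)) ×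
        (∀ p → PvIn p (F i) → (∃ λ l → PvIn p (S l)) × n < p) ×
        (∀ x → FreeIn x (F i) → ∃ λ l → FreeIn x (S l))) ×
      (∀ i → QGL⊢ (F i ⇔ (S i ⟦ F ⟧)))
lemma6p7 n S ΣS bound∉free = F ∘ toℕ , (λ i → confined (proj₁ (proj₂ solution (toℕ i) (toℕ<n i)))) , solves
  where
  open Fixpoints (λ k j → ∃ λ l → PredIn k j (S l)) (λ x → ∃ λ l → FreeIn x (S l))
                 (λ x → ∃ λ l → BoundIn x (S l)) (λ (l , b) (l′ , f) → bound∉free l l′ _ b f)

  V : ℕ → Set
  V p = ∃ λ l → PvIn p (S l)

  W-tuple : ∀ j → j < suc n → Within V (tuple S j)
  W-tuple j j<1+n with tuple-< S j<1+n
  ... | l , e = subst (Within V) (sym e) (record { preds = l ,_ ; pvars = l ,_ ; frees = l ,_ ; bounds = l ,_ })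

  Σ-tuple : ∀ j → j < suc n → IsΣ (tuple S j)
  Σ-tuple j j<1+n with tuple-< S j<1+n
  ... | l , e = subst IsΣ (sym e) (ΣS l)

  solution : Solution (suc n) V (tuple S)
  solution = fixpoints (suc n) (tuple S) Σ-tuple W-tuple

  F : ℕ → Form
  F = proj₁ solution

  confined : ∀ {A} → Within (V ∩≥ suc n) A →
             (∀ k j → PredIn k j A → ∃ λ l → PredIn k j (S l)) ×
             (∀ p → PvIn p A → V p × n < p) ×
             (∀ x → FreeIn x A → ∃ λ l → FreeIn x (S l))
  confined W = (λ _ _ → preds W) , (λ _ → pvars W) , (λ _ → frees W)

  solves : ∀ i → QGL⊢ (F (toℕ i) ⇔ (S i ⟦ F ∘ toℕ ⟧))
  solves i = subst (λ B → QGL⊢ (F (toℕ i) ⇔ B))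
               (trans (cong (substP _) (tuple-toℕ S i)) (substP-cong (S i) λ {j} _ → tupleℕ-toℕ F j))
               (proj₂ (proj₂ solution (toℕ i) (toℕ<n i)))
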